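{- Let $f(H)$ denote the defective chromatic number of the class of $H$-minor-free graphs. Then $f(H)=1$ if and only if $H$ is a star plus some isolated vertices.
   Context: A star is a graph $K_{1,k}$. A graph is $(k,d)$-colourable if each vertex can be given one of $k$ colours so that each vertex has at most $d$ neighbours of its own colour. The defective chromatic number of a class is the minimum $k$ such that for some $d$ every graph in the class is $(k,d)$-colourable. -}

module Defs where

open import Data.Nat using (ℕ; zero; suc; _+_; _≤_; _<_; _≤ᵇ_)
open import Data.Fin using (Fin; toℕ) renaming (zero to fzero; suc to fsuc)
open import Data.Fin.Properties using (_≟_)
open import Data.Bool using (Bool; true; false; _∧_; _∨_)
open import Data.Bool.Properties using (∨-comm; ∧-comm)
open import Data.List using (List; length; filter; map)
open import Data.List.Base using ()
open import Data.Vec.Functional using ()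
open import Data.Fin using () renaming (_≟_ to _≟ᶠ_)
open import Data.Maybe using (Maybe; just; nothing)
open import Data.Product using (Σ; ∃; ∃-syntax; _×_; _,_)
open import Data.Empty using (⊥)
open import Relation.Nullary using (¬_; Dec; yes; no)
open import Relation.Binary.PropositionalEquality using (_≡_; refl)
open import Function.Bundles using (_↔_; Inverse)

open import Data.List using () renaming (allFin to allFinL)
open import Relation.Nullary.Decidable using (⌊_⌋)

record Graph : Set where
  field
    n     : ℕ
    adj   : Fin n → Fin n → Bool
    sym   : ∀ u v → adj u v ≡ adj v u
    loopless : ∀ v → adj v v ≡ false
open Graph public

_≅_ : Graph → Graph → Set
G ≅ H = Σ (Fin (n G) ↔ Fin (n H)) λ σ →
  ∀ u v → adj H (Inverse.to σ u) (Inverse.to σ v) ≡ adj G u v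

HasEdge : Graph → Set
HasEdge H = Σ (Fin (n H)) λ u → Σ (Fin (n H)) λ v → adj H u v ≡ true

-- Minors, via models (branch sets).
-- A partial map ρ : V(G) → Maybe V(H) assigns vertices of G to branch
-- sets (so branch sets are automatically pairwise disjoint).

InBranch : ∀ {G : Graph} {h : ℕ} → (Fin (n G) → Maybe (Fin h)) → Fin h → Fin (n G) → Set
InBranch ρ x v = ρ v ≡ just x

data Reach (G : Graph) (S : Fin (n G) → Set) : Fin (n G) → Fin (n G) → Set where
  here : ∀ {u} → Reach G S u u
  step : ∀ {u w v} → S w → adj G u w ≡ true → Reach G S w v → Reach G S u v

_≼_ : Graph → Graph → Set
H ≼ G = Σ (Fin (n G) → Maybe (Fin (n H))) λ ρ →
    (∀ x → Σ (Fin (n G)) λ v → ρ v ≡ just x)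
  ×
    (∀ x u v → ρ u ≡ just x → ρ v ≡ just x → Reach G (λ w → ρ w ≡ just x) u v)
  ×
    (∀ x y → adj H x y ≡ true →
       Σ (Fin (n G)) λ u → Σ (Fin (n G)) λ v →
         ρ u ≡ just x × ρ v ≡ just y × adj G u v ≡ true)

MinorFree : Graph → Graph → Set
MinorFree H G = ¬ (H ≼ G)

monoDeg : ∀ (G : Graph) {k} → (Fin (n G) → Fin k) → Fin (n G) → ℕ
monoDeg G c v = length (filter (λ w → adj G v w ∧ ⌊ c v ≟ᶠ c w ⌋ Data.Bool.≟ true) (allFinL (n G)))
  where import Data.Bool

Colourable : Graph → ℕ → ℕ → Set
Colourable G k d = Σ (Fin (n G) → Fin k) λ c → ∀ v → monoDeg G c v ≤ d

ClassColourable : (Graph → Set) → ℕ → Set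
ClassColourable C k = ∃[ d ] (∀ G → C G → Colourable G k d)

DefChromNum : (Graph → Set) → ℕ → Set
DefChromNum C m = ClassColourable C m × (∀ k → k < m → ¬ ClassColourable C k)

-- The star K_{1,k} plus m isolated vertices, on Fin (1 + k + m):
-- vertex 0 is the centre, vertices 1..k are the leaves, the rest isolated.

isCentre : ∀ {N} → Fin N → Bool
isCentre fzero = true
isCentre (fsuc _) = false

isLeaf : (k : ℕ) → ∀ {N} → Fin N → Bool
isLeaf k fzero = false
isLeaf k (fsuc v) = suc (toℕ v) ≤ᵇ k

starAdj : (k m : ℕ) → Fin (suc (k + m)) → Fin (suc (k + m)) → Bool
starAdj k m u v = (isCentre u ∧ isLeaf k v) ∨ (isLeaf k u ∧ isCentre v)

starAdj-sym : ∀ k m u v → starAdj k m u v ≡ starAdj k m v u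
starAdj-sym k m u v
  rewrite ∧-comm (isCentre u) (isLeaf k v) | ∧-comm (isLeaf k u) (isCentre v)
  = ∨-comm (isLeaf k v ∧ isCentre u) (isCentre v ∧ isLeaf k u)

starAdj-loop : ∀ k m v → starAdj k m v v ≡ false
starAdj-loop k m fzero = refl
starAdj-loop k m (fsuc v) with suc (toℕ v) ≤ᵇ k
... | true = refl
... | false = refl

StarPlusIsolated : ℕ → ℕ → Graph
StarPlusIsolated k m = record
  { n = suc (k + m) ; adj = starAdj k m
  ; sym = starAdj-sym k m ; loopless = starAdj-loop k m }

IsStarPlusIsolated : Graph → Set
IsStarPlusIsolated H = ∃[ k ] ∃[ m ] (1 ≤ k × H ≅ StarPlusIsolated k m)

module Submission where

-- Call c a centre of a graph if every edge meets c.  Stars plus isolated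
-- vertices are exactly the centred graphs with an edge, which we prove by
-- sorting the vertices into centre, leaves and the rest (counting each part).
--
-- (⇐) If H ≅ K_{1,k} + m·K_1, any vertex with k + m distinct neighbours
-- spans a model of H.  So an H-minor-free graph has every degree below k + m
-- and the constant colouring is a (1, k + m)-colouring.  No class containing
-- the one-vertex graph K_1 is 0-colourable, and K_1 is H-minor-free.
--
-- (⇒) If every H-minor-free graph is (1,d)-colourable, the star K_{1,d+1} is
-- not, so it is not H-minor-free.  Any minor with an edge of a centred graph is
-- centred, hence H is centred.  The contradiction argument only yields
-- ¬¬(H centred); as being centred is decidable this suffices.

open import Defs renaming (sym to adj-sym)
open import Data.Nat using (ℕ; zero; suc; _+_; _≤_; _<_; _≤ᵇ_; z≤n; s≤s)
import Data.Nat.Properties as NP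
open import Data.Fin using (Fin; toℕ; _↑ˡ_; _↑ʳ_; splitAt; inject≤)
  renaming (zero to fzero; suc to fsuc)
import Data.Fin.Properties as FP
open import Data.Bool using (Bool; true; false; _∧_; _∨_; not; T)
import Data.Bool.Properties as BP
open import Data.Sum using (_⊎_; inj₁; inj₂)
open import Data.Sum.Function.Propositional using (_⊎-↔_)
open import Data.Product using (Σ; _×_; _,_; proj₁; proj₂)
open import Data.Empty using (⊥; ⊥-elim)
open import Data.Unit using (tt)
open import Data.Maybe using (Maybe; just; nothing)
import Data.Maybe as Maybe
open import Data.Maybe.Properties using (just-injective)
open import Data.List using (length; filter; tabulate) renaming (allFin to allFinL)
open import Relation.Nullary using (¬_; Dec; yes; no)
open import Relation.Nullary.Decidable using (⌊_⌋; _→-dec_; _⊎-dec_)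
open import Relation.Binary.PropositionalEquality
open import Function using (_∘_)
open import Function.Bundles using (_↔_; Inverse; mk↔ₛ′; _⇔_; mk⇔)
open import Function.Construct.Composition using (_↔-∘_)
open import Function.Construct.Symmetry using (↔-sym)
import Axiom.UniquenessOfIdentityProofs as UIP

true≢false : true ≡ false → ⊥
true≢false ()

bool-UIP : ∀ {a b : Bool} (e e′ : a ≡ b) → e ≡ e′
bool-UIP = UIP.Decidable⇒UIP.≡-irrelevant BP._≟_

nothing≢just : ∀ {A : Set} {a : A} → nothing ≡ just a → ⊥
nothing≢just ()

∧-true-left : ∀ {a b} → a ∧ b ≡ true → a ≡ true
∧-true-left {true} _ = refl

-- The degree
-- function monoDeg of Defs is literally such a count, and the bijection below
-- turns counts into sets of distinct witnesses and back.

Count : ∀ {n} → (Fin n → Bool) → ℕ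
Count {n} p = length (filter (λ i → p i BP.≟ true) (allFinL n))

Holds : ∀ {n} → (Fin n → Bool) → Set
Holds {n} p = Σ (Fin n) λ i → p i ≡ true

Σ-Fin-suc : ∀ {n} (P : Fin (suc n) → Set) → Σ (Fin (suc n)) P ↔ (P fzero ⊎ Σ (Fin n) (P ∘ fsuc))
Σ-Fin-suc P = mk↔ₛ′ split merge split∘merge merge∘split
  where
  split : Σ _ P → P fzero ⊎ Σ _ (P ∘ fsuc)
  split (fzero , x) = inj₁ x
  split (fsuc i , x) = inj₂ (i , x)
  merge : P fzero ⊎ Σ _ (P ∘ fsuc) → Σ _ P
  merge (inj₁ x) = fzero , x
  merge (inj₂ (i , x)) = fsuc i , x
  split∘merge : ∀ s → split (merge s) ≡ s
  split∘merge (inj₁ x) = refl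
  split∘merge (inj₂ (i , x)) = refl
  merge∘split : ∀ s → merge (split s) ≡ s
  merge∘split (fzero , x) = refl
  merge∘split (fsuc i , x) = refl

true↔Fin1 : ∀ {b} → b ≡ true → (b ≡ true) ↔ Fin 1
true↔Fin1 e = mk↔ₛ′ (λ _ → fzero) (λ _ → e) (λ { fzero → refl ; (fsuc ()) }) (bool-UIP e)

false↔Fin0 : ∀ {b} → b ≡ false → (b ≡ true) ↔ Fin 0
false↔Fin0 e = mk↔ₛ′ (λ e′ → ⊥-elim (contra e′)) (λ ()) (λ ()) (λ e′ → ⊥-elim (contra e′))
  where
  contra : _ ≡ true → ⊥
  contra e′ = true≢false (trans (sym e′) e)

-- The positions where p ∘ f holds correspond to the elements kept by filtering
-- tabulate f; this is the induction behind holds↔Count.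
holdsAlong↔ : ∀ {A : Set} {n} (f : Fin n → A) (p : A → Bool) →
  Σ (Fin n) (λ i → p (f i) ≡ true) ↔ Fin (length (filter (λ x → p x BP.≟ true) (tabulate f)))
holdsAlong↔ {n = zero} f p = mk↔ₛ′ (λ { (() , _) }) (λ ()) (λ ()) (λ { (() , _) })
holdsAlong↔ {n = suc n} f p with p (f fzero) in e
... | true  = ↔-sym FP.+↔⊎ ↔-∘ ((true↔Fin1 e ⊎-↔ holdsAlong↔ (f ∘ fsuc) p) ↔-∘ Σ-Fin-suc _)
... | false = ↔-sym FP.+↔⊎ ↔-∘ ((false↔Fin0 e ⊎-↔ holdsAlong↔ (f ∘ fsuc) p) ↔-∘ Σ-Fin-suc _)

holds↔Count : ∀ {n} (p : Fin n → Bool) → Holds p ↔ Fin (Count p)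
holds↔Count p = holdsAlong↔ (λ i → i) p

count-lower : ∀ {n N} (p : Fin n → Bool) (e : Fin N → Fin n) →
  (∀ i j → e i ≡ e j → i ≡ j) → (∀ i → p (e i) ≡ true) → N ≤ Count p
count-lower p e inj holds = FP.injective⇒≤ {f = Inverse.to C ∘ witness} injective
  where
  C = holds↔Count p
  witness : ∀ i → Holds p
  witness i = e i , holds i
  injective : ∀ {i j} → Inverse.to C (witness i) ≡ Inverse.to C (witness j) → i ≡ j
  injective {i} {j} eq = inj i j (cong proj₁ (begin
    witness i                              ≡⟨ sym (Inverse.strictlyInverseʳ C _) ⟩
    Inverse.from C (Inverse.to C (witness i)) ≡⟨ cong (Inverse.from C) eq ⟩
    Inverse.from C (Inverse.to C (witness j)) ≡⟨ Inverse.strictlyInverseʳ C _ ⟩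
    witness j                              ∎))
    where open ≡-Reasoning

count-upper : ∀ {n N} (p : Fin n → Bool) → N ≤ Count p →
  Σ (Fin N → Fin n) λ e → (∀ i j → e i ≡ e j → i ≡ j) × (∀ i → p (e i) ≡ true)
count-upper p N≤ = proj₁ ∘ witness , injective , proj₂ ∘ witness
  where
  C = holds↔Count p
  witness = λ i → Inverse.from C (inject≤ i N≤)
  injective : ∀ i j → proj₁ (witness i) ≡ proj₁ (witness j) → i ≡ j
  injective i j eq = FP.inject≤-injective N≤ N≤ i j (begin
    inject≤ i N≤                        ≡⟨ sym (Inverse.strictlyInverseˡ C _) ⟩
    Inverse.to C (witness i)            ≡⟨ cong (Inverse.to C) (Σ-≡ eq) ⟩
    Inverse.to C (witness j)            ≡⟨ Inverse.strictlyInverseˡ C _ ⟩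
    inject≤ j N≤                        ∎)
    where
    open ≡-Reasoning
    Σ-≡ : ∀ {x y : Holds p} → proj₁ x ≡ proj₁ y → x ≡ y
    Σ-≡ {u , ex} {.u , ey} refl = cong (u ,_) (bool-UIP ex ey)

leaf-↑ˡ : ∀ k m (a : Fin k) → isLeaf k {suc (k + m)} (fsuc (a ↑ˡ m)) ≡ true
leaf-↑ˡ k m a with suc (toℕ (a ↑ˡ m)) ≤ᵇ k in eq
... | true = refl
... | false = ⊥-elim (subst T eq (NP.≤⇒≤ᵇ (subst (λ z → suc z ≤ k) (sym (FP.toℕ-↑ˡ a m)) (FP.toℕ<n a))))

nonleaf-↑ʳ : ∀ k m (b : Fin m) → isLeaf k {suc (k + m)} (fsuc (k ↑ʳ b)) ≡ false
nonleaf-↑ʳ k m b with suc (toℕ (k ↑ʳ b)) ≤ᵇ k in eq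
... | false = refl
... | true = ⊥-elim (NP.<-irrefl refl (NP.≤-trans (s≤s (NP.m≤m+n k (toℕ b))) k<…≤k))
  where
  k<…≤k : suc (k + toℕ b) ≤ k
  k<…≤k = subst (λ z → suc z ≤ k) (FP.toℕ-↑ʳ k b) (NP.≤ᵇ⇒≤ _ k (subst T (sym eq) tt))

Centre : (G : Graph) → Fin (n G) → Set
Centre G c = ∀ u v → adj G u v ≡ true → u ≡ c ⊎ v ≡ c

Centred : Graph → Set
Centred G = Σ (Fin (n G)) (Centre G)

centred? : ∀ G → Dec (Centred G)
centred? G = FP.any? λ c → FP.all? λ u → FP.all? λ v →
  (adj G u v BP.≟ true) →-dec ((u FP.≟ c) ⊎-dec (v FP.≟ c))

star-centre : ∀ k m → Centre (StarPlusIsolated k m) fzero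
star-centre k m fzero v e = inj₁ refl
star-centre k m (fsuc u) fzero e = inj₂ refl
star-centre k m (fsuc u) (fsuc v) e
  rewrite BP.∧-zeroʳ (isLeaf k {suc (k + m)} (fsuc u)) = ⊥-elim (true≢false (sym e))

inhabited⇒positive : ∀ {k} → Fin k → 1 ≤ k
inhabited⇒positive fzero = s≤s z≤n
inhabited⇒positive (fsuc _) = s≤s z≤n

-- A centred graph is a star plus isolated vertices: the star has as leaves the
-- k neighbours of the centre c, and the m remaining vertices are isolated.
module CentredIsStar (H : Graph) (c : Fin (n H)) (centre : Centre H c) where

  isC : Fin (n H) → Bool
  isC u = ⌊ u FP.≟ c ⌋

  isLeafH isOther : Fin (n H) → Bool
  isLeafH u = adj H c u
  isOther u = not (adj H c u) ∧ not (isC u)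

  k m : ℕ
  k = Count isLeafH
  m = Count isOther

  module L = Inverse (holds↔Count isLeafH)
  module O = Inverse (holds↔Count isOther)

  isC-refl : isC c ≡ true
  isC-refl with c FP.≟ c
  ... | yes _ = refl
  ... | no c≢c = ⊥-elim (c≢c refl)

  isC-no : ∀ {u} → ¬ u ≡ c → isC u ≡ false
  isC-no {u} u≢c with u FP.≟ c
  ... | yes u≡c = ⊥-elim (u≢c u≡c)
  ... | no _ = refl

  leaf≢c : ∀ {u} → isLeafH u ≡ true → ¬ u ≡ c
  leaf≢c e refl = true≢false (trans (sym e) (loopless H c))

  other⇒nonleaf : ∀ {u} → isOther u ≡ true → isLeafH u ≡ false
  other⇒nonleaf {u} e with adj H c u
  ... | false = refl

  other≢c : ∀ {u} → isOther u ≡ true → ¬ u ≡ c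
  other≢c e refl rewrite isC-refl | BP.∧-zeroʳ (not (adj H c c)) = true≢false (sym e)

  isOther-intro : ∀ {u} → adj H c u ≡ false → ¬ u ≡ c → isOther u ≡ true
  isOther-intro {u} e u≢c rewrite e | isC-no u≢c = refl

  data Kind (u : Fin (n H)) : Set where
    centreK : u ≡ c → Kind u
    leafK   : isLeafH u ≡ true → Kind u
    otherK  : isOther u ≡ true → Kind u

  kind : ∀ u → Kind u
  kind u with u FP.≟ c
  ... | yes u≡c = centreK u≡c
  ... | no u≢c with adj H c u in e
  ...   | true = leafK e
  ...   | false = otherK (isOther-intro e u≢c)

  number : ∀ u → Kind u → Fin (suc (k + m))
  number u (centreK _) = fzero
  number u (leafK e) = fsuc (L.to (u , e) ↑ˡ m)
  number u (otherK e) = fsuc (k ↑ʳ O.to (u , e))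

  to : Fin (n H) → Fin (suc (k + m))
  to u = number u (kind u)

  from : Fin (suc (k + m)) → Fin (n H)
  from fzero = c
  from (fsuc j) with splitAt k j
  ... | inj₁ a = proj₁ (L.from a)
  ... | inj₂ b = proj₁ (O.from b)

  -- The numbering does not depend on which proof of the kind is used.
  to-centre : to c ≡ fzero
  to-centre with kind c
  ... | centreK _ = refl
  ... | leafK e = ⊥-elim (leaf≢c e refl)
  ... | otherK e = ⊥-elim (other≢c e refl)

  to-leaf : ∀ u (e : isLeafH u ≡ true) → to u ≡ fsuc (L.to (u , e) ↑ˡ m)
  to-leaf u e with kind u
  ... | centreK u≡c = ⊥-elim (leaf≢c e u≡c)
  ... | leafK e′ = cong (λ z → fsuc (L.to (u , z) ↑ˡ m)) (bool-UIP e′ e)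
  ... | otherK e′ = ⊥-elim (true≢false (trans (sym e) (other⇒nonleaf e′)))

  to-other : ∀ u (e : isOther u ≡ true) → to u ≡ fsuc (k ↑ʳ O.to (u , e))
  to-other u e with kind u
  ... | centreK u≡c = ⊥-elim (other≢c e u≡c)
  ... | leafK e′ = ⊥-elim (true≢false (trans (sym e′) (other⇒nonleaf e)))
  ... | otherK e′ = cong (λ z → fsuc (k ↑ʳ O.to (u , z))) (bool-UIP e′ e)

  to∘from : ∀ j → to (from j) ≡ j
  to∘from fzero = to-centre
  to∘from (fsuc j) with splitAt k j | FP.join-splitAt k m j
  ... | inj₁ a | refl = trans (to-leaf _ (proj₂ (L.from a))) (cong (λ z → fsuc (z ↑ˡ m)) (L.strictlyInverseˡ a))
  ... | inj₂ b | refl = trans (to-other _ (proj₂ (O.from b))) (cong (λ z → fsuc (k ↑ʳ z)) (O.strictlyInverseˡ b))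

  from∘to : ∀ u → from (to u) ≡ u
  from∘to u with kind u
  ... | centreK u≡c = sym u≡c
  ... | leafK e rewrite FP.splitAt-↑ˡ k (L.to (u , e)) m = cong proj₁ (L.strictlyInverseʳ (u , e))
  ... | otherK e rewrite FP.splitAt-↑ʳ k m (O.to (u , e)) = cong proj₁ (O.strictlyInverseʳ (u , e))

  isCentre-to : ∀ u → isCentre (to u) ≡ isC u
  isCentre-to u with kind u
  ... | centreK refl = sym isC-refl
  ... | leafK e = sym (isC-no (leaf≢c e))
  ... | otherK e = sym (isC-no (other≢c e))

  isLeaf-to : ∀ u → isLeaf k (to u) ≡ isLeafH u
  isLeaf-to u with kind u
  ... | centreK refl = sym (loopless H c)
  ... | leafK e = trans (leaf-↑ˡ k m _) (sym e)
  ... | otherK e = trans (nonleaf-↑ʳ k m _) (sym (other⇒nonleaf e))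

  -- Since c is a centre, adjacency in H is determined by adjacency to c.
  adj-via-centre : ∀ u v → (isC u ∧ adj H c v) ∨ (adj H c u ∧ isC v) ≡ adj H u v
  adj-via-centre u v with u FP.≟ c | v FP.≟ c
  ... | yes refl | yes refl rewrite loopless H c = refl
  ... | yes refl | no _ rewrite loopless H c = BP.∨-identityʳ (adj H c v)
  ... | no _ | yes refl = trans (BP.∧-identityʳ (adj H c u)) (adj-sym H c u)
  ... | no u≢c | no v≢c rewrite BP.∧-zeroʳ (adj H c u) with adj H u v in e
  ...   | false = refl
  ...   | true with centre u v e
  ...     | inj₁ u≡c = ⊥-elim (u≢c u≡c)
  ...     | inj₂ v≡c = ⊥-elim (v≢c v≡c)

  isomorphism : H ≅ StarPlusIsolated k m
  isomorphism = mk↔ₛ′ to from to∘from from∘to , preserves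
    where
    preserves : ∀ u v → starAdj k m (to u) (to v) ≡ adj H u v
    preserves u v rewrite isCentre-to u | isCentre-to v | isLeaf-to u | isLeaf-to v = adj-via-centre u v

  -- An edge of H has an endpoint c and its other endpoint is a leaf, so k ≥ 1.
  leaves-exist : HasEdge H → 1 ≤ k
  leaves-exist (x , y , e) with centre x y e
  ... | inj₁ refl = inhabited⇒positive (L.to (y , e))
  ... | inj₂ refl = inhabited⇒positive (L.to (x , trans (adj-sym H c x) e))

centred⇒starPlusIsolated : ∀ H → HasEdge H → Centred H → IsStarPlusIsolated H
centred⇒starPlusIsolated H edge (c , centre) = k , m , leaves-exist edge , isomorphism
  where open CentredIsStar H c centre

-- Minors are invariant under isomorphism of the minor: relabel the branch sets.
reach-mono : ∀ {G : Graph} {S S′ : Fin (n G) → Set} → (∀ w → S w → S′ w) →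
  ∀ {u v} → Reach G S u v → Reach G S′ u v
reach-mono f here = here
reach-mono f (step s a r) = step (f _ s) a (reach-mono f r)

≅-≼ : ∀ H S G → H ≅ S → S ≼ G → H ≼ G
≅-≼ H S G (σ , iso) (ρ , nonempty , connected , edges) =
  ρ′ , nonempty′ , connected′ , edges′
  where
  module σ = Inverse σ
  ρ′ : Fin (n G) → Maybe (Fin (n H))
  ρ′ u = Maybe.map σ.from (ρ u)
  back : ∀ u x → ρ u ≡ just (σ.to x) → ρ′ u ≡ just x
  back u x e rewrite e = cong just (σ.strictlyInverseʳ x)
  forth : ∀ u x → ρ′ u ≡ just x → ρ u ≡ just (σ.to x)
  forth u x e with ρ u
  ... | just y = cong just (trans (sym (σ.strictlyInverseˡ y)) (cong σ.to (just-injective e)))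
  ... | nothing = ⊥-elim (nothing≢just e)
  nonempty′ : ∀ x → Σ (Fin (n G)) λ v → ρ′ v ≡ just x
  nonempty′ x with nonempty (σ.to x)
  ... | v , e = v , back v x e
  connected′ : ∀ x u v → ρ′ u ≡ just x → ρ′ v ≡ just x → Reach G (λ w → ρ′ w ≡ just x) u v
  connected′ x u v eu ev =
    reach-mono (λ w e → back w x e) (connected (σ.to x) u v (forth u x eu) (forth v x ev))
  edges′ : ∀ x y → adj H x y ≡ true → Σ (Fin (n G)) λ u → Σ (Fin (n G)) λ v →
           ρ′ u ≡ just x × ρ′ v ≡ just y × adj G u v ≡ true
  edges′ x y a with edges (σ.to x) (σ.to y) (trans (iso x y) a)
  ... | u , v , eu , ev , b = u , v , back u x eu , back v y ev , b

-- A minor with an edge of a centred graph is centred: every edge of the minor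
-- is realised by an edge through the centre c, so it meets the branch set of c.
minor-of-centred : ∀ H G → HasEdge H → H ≼ G → Centred G → Centred H
minor-of-centred H G (x , y , exy) (ρ , _ , _ , edges) (c , centre) with ρ c in ec
... | just z = z , centre′
  where
  centre′ : Centre H z
  centre′ x′ y′ e with edges x′ y′ e
  ... | u , v , eu , ev , a with centre u v a
  ... | inj₁ refl = inj₁ (just-injective (trans (sym eu) ec))
  ... | inj₂ refl = inj₂ (just-injective (trans (sym ev) ec))
... | nothing with edges x y exy
... | u , v , eu , ev , a with centre u v a
... | inj₁ refl = ⊥-elim (nothing≢just (trans (sym ec) eu))
... | inj₂ refl = ⊥-elim (nothing≢just (trans (sym ec) ev))

-- A vertex v0 with k + m distinct neighbours gives a model of a star plus
-- isolated vertices: branch sets are singletons, {v0} for the centre and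
-- {e i} for the other vertices.
module NeighbourhoodModel (G : Graph) (k m : ℕ) (v0 : Fin (n G))
  (e : Fin (k + m) → Fin (n G)) (e-injective : ∀ i j → e i ≡ e j → i ≡ j)
  (e-adjacent : ∀ i → adj G v0 (e i) ≡ true) where

  e≢v0 : ∀ i → ¬ e i ≡ v0
  e≢v0 i eq = true≢false (trans (sym (e-adjacent i)) (trans (cong (adj G v0) eq) (loopless G v0)))

  branch : ∀ u → Dec (u ≡ v0) → Dec (Σ (Fin (k + m)) λ i → e i ≡ u) → Maybe (Fin (suc (k + m)))
  branch u (yes _) _ = just fzero
  branch u (no _) (yes (i , _)) = just (fsuc i)
  branch u (no _) (no _) = nothing

  ρ : Fin (n G) → Maybe (Fin (suc (k + m)))
  ρ u = branch u (u FP.≟ v0) (FP.any? λ i → e i FP.≟ u)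

  ρ-v0 : ρ v0 ≡ just fzero
  ρ-v0 with v0 FP.≟ v0
  ... | yes _ = refl
  ... | no v0≢v0 = ⊥-elim (v0≢v0 refl)

  ρ-e : ∀ i → ρ (e i) ≡ just (fsuc i)
  ρ-e i with e i FP.≟ v0 | FP.any? (λ j → e j FP.≟ e i)
  ... | yes eq | _ = ⊥-elim (e≢v0 i eq)
  ... | no _ | yes (j , ej) = cong (just ∘ fsuc) (e-injective j i ej)
  ... | no _ | no none = ⊥-elim (none (i , refl))

  singleton : ∀ x u w → ρ u ≡ just x → ρ w ≡ just x → u ≡ w
  singleton x u w eu ew = trans (represent u x eu) (sym (represent w x ew))
    where
    vertexOf : Fin (suc (k + m)) → Fin (n G)
    vertexOf fzero = v0
    vertexOf (fsuc i) = e i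
    represent : ∀ u x → ρ u ≡ just x → u ≡ vertexOf x
    represent u x eq with u FP.≟ v0 | FP.any? (λ i → e i FP.≟ u)
    ... | yes u≡v0 | _ rewrite sym (just-injective eq) = u≡v0
    ... | no _ | yes (i , ei) rewrite sym (just-injective eq) = sym ei
    ... | no _ | no _ = ⊥-elim (nothing≢just eq)

  model : StarPlusIsolated k m ≼ G
  model = ρ , nonempty , connected , edges
    where
    nonempty : ∀ x → Σ (Fin (n G)) λ v → ρ v ≡ just x
    nonempty fzero = v0 , ρ-v0
    nonempty (fsuc i) = e i , ρ-e i
    connected : ∀ x u v → ρ u ≡ just x → ρ v ≡ just x → Reach G (λ w → ρ w ≡ just x) u v
    connected x u v eu ev = subst (Reach G (λ w → ρ w ≡ just x) u) (singleton x u v eu ev) here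
    edges : ∀ x y → starAdj k m x y ≡ true → Σ (Fin (n G)) λ u → Σ (Fin (n G)) λ v →
            ρ u ≡ just x × ρ v ≡ just y × adj G u v ≡ true
    edges fzero fzero ()
    edges fzero (fsuc j) _ = v0 , e j , ρ-v0 , ρ-e j , e-adjacent j
    edges (fsuc i) fzero _ = e i , v0 , ρ-e i , ρ-v0 , trans (adj-sym G (e i) v0) (e-adjacent i)
    edges (fsuc i) (fsuc j) a with star-centre k m (fsuc i) (fsuc j) a
    ... | inj₁ ()
    ... | inj₂ ()

neighbours-of-monoDeg : ∀ G {q} (col : Fin (n G) → Fin q) v {N} → N ≤ monoDeg G col v →
  Σ (Fin N → Fin (n G)) λ e → (∀ i j → e i ≡ e j → i ≡ j) × (∀ i → adj G v (e i) ≡ true)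
neighbours-of-monoDeg G col v N≤ with count-upper _ N≤
... | e , injective , mono = e , injective , ∧-true-left ∘ mono

one-colour : ∀ {A : Set} (col : A → Fin 1) x y → ⌊ col x FP.≟ col y ⌋ ≡ true
one-colour col x y with col x | col y
... | fzero | fzero = refl

star-monoDeg : ∀ k m (col : Fin (suc (k + m)) → Fin 1) →
  k ≤ monoDeg (StarPlusIsolated k m) col fzero
star-monoDeg k m col = count-lower monochromatic leaf injective adjacent
  where
  monochromatic : Fin (suc (k + m)) → Bool
  monochromatic w = starAdj k m fzero w ∧ ⌊ col fzero FP.≟ col w ⌋
  leaf : Fin k → Fin (suc (k + m))
  leaf a = fsuc (a ↑ˡ m)
  injective : ∀ a b → leaf a ≡ leaf b → a ≡ b
  injective a b eq = FP.↑ˡ-injective m a b (FP.suc-injective eq)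
  adjacent : ∀ a → monochromatic (leaf a) ≡ true
  adjacent a rewrite leaf-↑ˡ k m a | one-colour col fzero (leaf a) = refl

K1 : Graph
K1 = record { n = 1 ; adj = λ _ _ → false ; sym = λ _ _ → refl ; loopless = λ _ → refl }

K1-minorFree : ∀ H → HasEdge H → MinorFree H K1
K1-minorFree H (x , y , exy) (ρ , nonempty , _ , edges) with edges x y exy
... | _ , _ , _ , _ , ()

star-minor : ∀ G {q} (col : Fin (n G) → Fin q) v k m → ¬ monoDeg G col v ≤ k + m →
  StarPlusIsolated k m ≼ G
star-minor G col v k m high with neighbours-of-monoDeg G col v (NP.<⇒≤ (NP.≰⇒> high))
... | e , injective , adjacent = NeighbourhoodModel.model G k m v e injective adjacent

star-not-colourable : ∀ d → ¬ Colourable (StarPlusIsolated (suc d) 0) 1 d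
star-not-colourable d (col , bounded) = NP.≤⇒≯ (bounded fzero) (star-monoDeg (suc d) 0 col)

K1-needs-a-colour : ∀ (C : Graph → Set) → C K1 → ∀ k → k < 1 → ¬ ClassColourable C k
K1-needs-a-colour C K1∈C zero _ (d , colourable) with proj₁ (colourable K1 K1∈C) fzero
... | ()
K1-needs-a-colour C K1∈C (suc k) (s≤s ())

-- (⇐) Minor-free graphs for a star plus isolated vertices have bounded degree.
starPlusIsolated⇒chromatic1 : ∀ H → HasEdge H → IsStarPlusIsolated H → DefChromNum (MinorFree H) 1
starPlusIsolated⇒chromatic1 H edge (k , m , _ , H≅star) =
  (k + m , constant-colouring) , K1-needs-a-colour (MinorFree H) (K1-minorFree H edge)
  where
  constant-colouring : ∀ G → MinorFree H G → Colourable G 1 (k + m)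
  constant-colouring G free = (λ _ → fzero) , bounded
    where
    bounded : ∀ v → monoDeg G {1} (λ _ → fzero) v ≤ k + m
    bounded v with monoDeg G {1} (λ _ → fzero) v NP.≤? k + m
    ... | yes small = small
    ... | no high = ⊥-elim (free (≅-≼ H (StarPlusIsolated k m) G H≅star (star-minor G {1} (λ _ → fzero) v k m high)))

-- (⇒) H is a minor of the centred graph K_{1,d+1}, hence centred itself.
chromatic1⇒starPlusIsolated : ∀ H → HasEdge H → DefChromNum (MinorFree H) 1 → IsStarPlusIsolated H
chromatic1⇒starPlusIsolated H edge ((d , colourable) , _) with centred? H
... | yes centred = centred⇒starPlusIsolated H edge centred
... | no ¬centred = ⊥-elim (star-not-colourable d (colourable star star-minorFree))
  where
  star = StarPlusIsolated (suc d) 0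
  star-minorFree : MinorFree H star
  star-minorFree H≼star = ¬centred (minor-of-centred H star edge H≼star (fzero , star-centre (suc d) 0))

proposition33 : (H : Graph) → HasEdge H →
    DefChromNum (MinorFree H) 1 ⇔ IsStarPlusIsolated H
proposition33 H edge = mk⇔ (chromatic1⇒starPlusIsolated H edge) (starPlusIsolated⇒chromatic1 H edge)
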